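{- Let $K$ be a valued field and $d, r \in \mathbb{N}_{\geq 1}$. Then any finite set $X \subseteq K^d$ with $|X| \geq (d+1)(r-1)+1$ can be partitioned into subsets $X_1,\ldots,X_r$ such that $|X_i| = d+1$ for $i < r$, $|X_r| = |X| - (d+1)(r-1)$, and $\operatorname{conv}(X_i) \supseteq \operatorname{conv}(X_j)$ for all $i \leq j$ in $[r]$.
   Context: $K$ is a field with a valuation $\nu$ and valuation ring $\mathcal{O} = \{x:\nu(x)\ge0\}$. For $Y \subseteq K^d$, its convex hull is $\operatorname{conv}(Y) = \{\sum_{i=1}^n \alpha_i y_i : n \geq 1, y_i \in Y, \alpha_i \in \mathcal{O}, \sum_i \alpha_i = 1\}$. -}

module Defs where

open import Level using (Level; _⊔_) renaming (suc to lsuc)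
open import Data.Nat using (ℕ; suc)
open import Data.Fin using (Fin; _≟_)
open import Data.List using (length; filter; allFin)
open import Data.Maybe using (Maybe; just; nothing)
open import Data.Unit.Polymorphic using (⊤)
open import Data.Empty.Polymorphic using (⊥)
open import Data.Product using (Σ; ∃; _×_)
open import Data.Sum using (_⊎_)
open import Relation.Nullary using (¬_)
open import Relation.Binary.PropositionalEquality using (_≡_)
open import Relation.Binary.Structures using (IsTotalOrder)
open import Algebra.Bundles using (CommutativeRing; AbelianGroup)
import Algebra.Definitions.RawMonoid as RawMonoidDefs

-- Γ ∪ {∞}, with nothing = ∞
module Extended {g gℓ} (Γ : AbelianGroup g gℓ) (_≤_ : AbelianGroup.Carrier Γ → AbelianGroup.Carrier Γ → Set gℓ) where
  open AbelianGroup Γ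
  Γ∞ : Set g
  Γ∞ = Maybe Carrier

  IsInf : Γ∞ → Set gℓ
  IsInf nothing = ⊤
  IsInf (just _) = ⊥

  _≤∞_ : Γ∞ → Γ∞ → Set gℓ
  just a ≤∞ just b = a ≤ b
  _ ≤∞ nothing = ⊤
  nothing ≤∞ just _ = ⊥

  _≈∞_ : Γ∞ → Γ∞ → Set gℓ
  just a ≈∞ just b = a ≈ b
  nothing ≈∞ nothing = ⊤
  just _ ≈∞ nothing = ⊥
  nothing ≈∞ just _ = ⊥

  _+∞_ : Γ∞ → Γ∞ → Γ∞
  just a +∞ just b = just (a ∙ b)
  _ +∞ _ = nothing

record ValuedField (c ℓ g gℓ : Level) : Set (lsuc (c ⊔ ℓ ⊔ g ⊔ gℓ)) where
  field
    commRing : CommutativeRing c ℓ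
  open CommutativeRing commRing public
  field
    nontrivial : ¬ (1# ≈ 0#)
    inverse    : ∀ x → ¬ (x ≈ 0#) → Σ Carrier (λ y → x * y ≈ 1#)
    Γ          : AbelianGroup g gℓ
    _≤Γ_       : AbelianGroup.Carrier Γ → AbelianGroup.Carrier Γ → Set gℓ
    ≤Γ-total   : IsTotalOrder (AbelianGroup._≈_ Γ) _≤Γ_
    ≤Γ-compat  : ∀ a b c → a ≤Γ b → AbelianGroup._∙_ Γ a c ≤Γ AbelianGroup._∙_ Γ b c
  open Extended Γ _≤Γ_ public
  field
    ν       : Carrier → Γ∞
    ν-cong  : ∀ x y → x ≈ y → ν x ≈∞ ν y
    ν-inf₁  : ∀ x → IsInf (ν x) → x ≈ 0#
    ν-inf₂  : ∀ x → x ≈ 0# → IsInf (ν x)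
    ν-mul   : ∀ x y → ν (x * y) ≈∞ (ν x +∞ ν y)
    -- ν(x+y) ≥ min(ν x, ν y), written out for a total order
    ν-add   : ∀ x y → (ν x ≤∞ ν (x + y)) ⊎ (ν y ≤∞ ν (x + y))

module _ {c ℓ g gℓ} (K : ValuedField c ℓ g gℓ) where
  open ValuedField K

  InO : Carrier → Set gℓ
  InO x = just (AbelianGroup.ε Γ) ≤∞ ν x

  sumK : ∀ {m} → (Fin m → Carrier) → Carrier
  sumK = RawMonoidDefs.sum +-rawMonoid

  Point : ℕ → Set c
  Point d = Fin d → Carrier

  _≈P_ : ∀ {d} → Point d → Point d → Set ℓ
  p ≈P q = ∀ t → p t ≈ q t

  -- p ∈ conv(Y), where Y = { X k : S k } for a family X : Fin n → K^d
  InConv : ∀ {d n a} → (Fin n → Point d) → (Fin n → Set a) → Point d → Set (c ⊔ ℓ ⊔ gℓ ⊔ a)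
  InConv {d} {n} X S p =
    ∃ λ m → Σ (Fin (suc m) → Fin n) λ ys → (∀ k → S (ys k)) ×
      Σ (Fin (suc m) → Carrier) λ α → (∀ k → InO (α k)) ×
        (sumK α ≈ 1#) × (p ≈P (λ t → sumK (λ k → α k * X (ys k) t)))

fiberSize : ∀ {n r} → (Fin n → Fin r) → Fin r → ℕ
fiberSize {n} f i = length (filter (λ k → f k ≟ i) (allFin n))

-- Given at least d + 1 points R ⊆ K^d, fix x₀ ∈ R. Gaussian elimination over the valuation
-- ring O, pivoting each time on an entry of minimal valuation, shows that all differences x − x₀
-- (x ∈ R) lie in the O-span of at most d of them. Hence every point of R is an O-combination
-- with weights summing to 1 of at most d + 1 points of R, and after padding there is a subset
-- B ⊆ R of size d + 1 with R ⊆ conv B. Peeling off such subsets r − 1 times yields parts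
-- X₁, …, X_r such that every point of X_j lies in conv X_i for i ≤ j, and the convex hull of
-- a subset of conv X_i stays inside conv X_i.

module Submission where

open import Defs
open import Algebra.Bundles using (AbelianGroup; Monoid; Ring)
open import Data.Bool using (Bool; true; false; _∧_; _∨_; not; if_then_else_)
open import Data.Bool.Properties using (∨-zeroʳ; ∧-identityʳ; ∧-zeroʳ)
open import Data.Empty using (⊥-elim)
open import Data.Fin using (Fin; zero; suc; toℕ; splitAt)
open import Data.Fin.Properties using (_≟_)
open import Data.List using (length; filter; tabulate)
open import Data.Maybe using (just; nothing)
open import Data.Nat using (ℕ; zero; suc; _∸_; _≤_; _<_; z≤n; s≤s)
open import Data.Nat.Properties using (m≤n⇒m≤1+n)
open import Data.Product using (Σ; _×_; _,_; proj₁; proj₂; map₁)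
open import Data.Sum using (_⊎_; inj₁; inj₂; [_,_]; [_,_]′)
open import Data.Sum.Properties using ([,]-map)
open import Data.Unit.Polymorphic using (tt)
open import Data.Vec.Functional using (_∷_; _++_)
open import Function using (_∘_; id)
open import Level using (Level; _⊔_; lower)
open import Relation.Nullary using (¬_; Dec; yes; no; does)
open import Relation.Nullary.Decidable using (dec-true)
open import Relation.Binary.Bundles using (Poset)
open import Relation.Binary.Structures using (IsTotalOrder)
open import Relation.Binary.PropositionalEquality as ≡ using (_≡_)
import Algebra.Properties.CommutativeSemigroup as CommutativeSemigroupProperties
import Algebra.Properties.Group as GroupProperties
import Algebra.Properties.Monoid.Sum as MonoidSum
import Algebra.Properties.Ring as RingProperties
import Algebra.Properties.Semiring.Sum as SemiringSum
import Data.Fin.Properties as Fin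
import Relation.Binary.Reasoning.PartialOrder as PosetReasoning
import Relation.Binary.Reasoning.Setoid as SetoidReasoning

module MonoidSums {c ℓ} (M : Monoid c ℓ) where
  open Monoid M
  open MonoidSum M using (sum; sum-cong-≗)
  open SetoidReasoning setoid

  sum-∘-++ : ∀ {a} {A : Set a} {m m′} (F : A → Carrier) (xs : Fin m → A) (ys : Fin m′ → A) →
             sum (F ∘ (xs ++ ys)) ≈ sum (F ∘ xs) ∙ sum (F ∘ ys)
  sum-∘-++ {m = zero}  F xs ys = sym (identityˡ _)
  sum-∘-++ {m = suc m} F xs ys = begin
    F (xs zero) ∙ sum (F ∘ (xs ++ ys) ∘ suc)
      ≡⟨ ≡.cong (F (xs zero) ∙_) (sum-cong-≗ (λ i → ≡.cong F ([,]-map (splitAt m i)))) ⟩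
    F (xs zero) ∙ sum (F ∘ ((xs ∘ suc) ++ ys))
      ≈⟨ ∙-congˡ (sum-∘-++ F (xs ∘ suc) ys) ⟩
    F (xs zero) ∙ (sum (F ∘ xs ∘ suc) ∙ sum (F ∘ ys))
      ≈⟨ assoc _ _ _ ⟨
    sum (F ∘ xs) ∙ sum (F ∘ ys) ∎

module RingSums {c ℓ} (R : Ring c ℓ) where
  open Ring R hiding (zero)
  open RingProperties R using (-1*x≈-x)
  open SemiringSum semiring using (sum; sum-cong-≋; *-distribˡ-sum)
  open SetoidReasoning setoid

  sum-neg : ∀ {m} (f : Fin m → Carrier) → sum (λ j → - f j) ≈ - sum f
  sum-neg f = begin
    sum (λ j → - f j)       ≈⟨ sum-cong-≋ (λ j → -1*x≈-x (f j)) ⟨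
    sum (λ j → - 1# * f j)  ≈⟨ *-distribˡ-sum (- 1#) f ⟨
    - 1# * sum f            ≈⟨ -1*x≈-x (sum f) ⟩
    - sum f                 ∎

module ValuationRing {c ℓ g gℓ} (K : ValuedField c ℓ g gℓ) where
  open ValuedField K hiding (zero)
  open RingProperties ring using (-1*x≈-x; -‿involutive)
  open SemiringSum semiring using (sum)
  open AbelianGroup Γ using (ε; _∙_)
  private
    module Γ = AbelianGroup Γ
    module ≤Γ = IsTotalOrder ≤Γ-total

    Γ-poset : Poset g gℓ gℓ
    Γ-poset = record { isPartialOrder = ≤Γ.isPartialOrder }

  ≈∞-sym : ∀ x y → x ≈∞ y → y ≈∞ x
  ≈∞-sym (just _) (just _) = Γ.sym
  ≈∞-sym nothing  nothing  _ = tt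

  ≈∞-trans : ∀ x y z → x ≈∞ y → y ≈∞ z → x ≈∞ z
  ≈∞-trans (just _) (just _) (just _) = Γ.trans
  ≈∞-trans nothing  nothing  nothing  _ _ = tt

  ≤∞-refl : ∀ x → x ≤∞ x
  ≤∞-refl (just _) = ≤Γ.refl
  ≤∞-refl nothing  = tt

  ≤∞-trans : ∀ x y z → x ≤∞ y → y ≤∞ z → x ≤∞ z
  ≤∞-trans (just _) (just _) (just _) = ≤Γ.trans
  ≤∞-trans (just _) nothing  (just _) _ ()
  ≤∞-trans nothing  nothing  (just _) _ ()
  ≤∞-trans (just _) _        nothing  _ _ = tt
  ≤∞-trans nothing  _        nothing  _ _ = tt

  ≤∞-respʳ-≈∞ : ∀ x y z → x ≤∞ y → y ≈∞ z → x ≤∞ z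
  ≤∞-respʳ-≈∞ (just _) (just _) (just _) x≤y y≈z = ≤Γ.trans x≤y (≤Γ.reflexive y≈z)
  ≤∞-respʳ-≈∞ nothing  (just _) (just _) ()
  ≤∞-respʳ-≈∞ _        nothing  (just _) _ ()
  ≤∞-respʳ-≈∞ (just _) _        nothing  _ _ = tt
  ≤∞-respʳ-≈∞ nothing  _        nothing  _ _ = tt

  ≤∞-total : ∀ x y → (x ≤∞ y) ⊎ (y ≤∞ x)
  ≤∞-total (just a) (just b) = ≤Γ.total a b
  ≤∞-total (just _) nothing  = inj₁ tt
  ≤∞-total nothing  nothing  = inj₁ tt
  ≤∞-total nothing  (just _) = inj₂ tt

  ≤∞-∞ : ∀ x y → IsInf y → x ≤∞ y
  ≤∞-∞ (just _) nothing _ = tt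
  ≤∞-∞ nothing  nothing _ = tt

  ∞≤∞⇒∞ : ∀ x y → IsInf x → x ≤∞ y → IsInf y
  ∞≤∞⇒∞ nothing nothing _ _ = tt

  ν-1# : ν 1# ≈∞ just ε
  ν-1# = idempotent⇒ε (ν 1#) (nontrivial ∘ ν-inf₁ 1#)
    (≈∞-trans (ν 1#) (ν (1# * 1#)) (ν 1# +∞ ν 1#) (ν-cong 1# (1# * 1#) (sym (*-identityˡ 1#))) (ν-mul 1# 1#))
    where
    idempotent⇒ε : ∀ x → ¬ IsInf x → x ≈∞ (x +∞ x) → x ≈∞ just ε
    idempotent⇒ε (just a) _  a≈a∙a = GroupProperties.identityʳ-unique Γ.group a a (Γ.sym a≈a∙a)
    idempotent⇒ε nothing  ¬∞ _     = ⊥-elim (¬∞ tt)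

  ε≤∞-+∞ : ∀ a b → just ε ≤∞ a → just ε ≤∞ b → just ε ≤∞ (a +∞ b)
  ε≤∞-+∞ (just a) (just b) ε≤a ε≤b = begin
    ε      ≈⟨ Γ.identityʳ ε ⟨
    ε ∙ ε  ≤⟨ ≤Γ-compat ε a ε ε≤a ⟩
    a ∙ ε  ≈⟨ Γ.comm a ε ⟩
    ε ∙ a  ≤⟨ ≤Γ-compat ε b a ε≤b ⟩
    b ∙ a  ≈⟨ Γ.comm b a ⟩
    a ∙ b  ∎
    where open PosetReasoning Γ-poset
  ε≤∞-+∞ (just _) nothing _ _ = tt
  ε≤∞-+∞ nothing  _       _ _ = tt

  ε≤∞-cancel : ∀ a b x → just ε ≈∞ (a +∞ b) → a ≤∞ x → just ε ≤∞ (x +∞ b)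
  ε≤∞-cancel (just a) (just b) (just x) ε≈a∙b a≤x = begin
    ε      ≈⟨ ε≈a∙b ⟩
    a ∙ b  ≤⟨ ≤Γ-compat a x b a≤x ⟩
    x ∙ b  ∎
    where open PosetReasoning Γ-poset
  ε≤∞-cancel (just _) (just _) nothing _ _ = tt

  ε≤∞-square : ∀ a → just ε ≈∞ (a +∞ a) → just ε ≤∞ a
  ε≤∞-square (just a) ε≈a∙a with ≤Γ.total a ε
  ... | inj₂ ε≤a = ε≤a
  ... | inj₁ a≤ε = begin
    ε      ≈⟨ ε≈a∙a ⟩
    a ∙ a  ≤⟨ ≤Γ-compat a ε a a≤ε ⟩
    ε ∙ a  ≈⟨ Γ.identityˡ a ⟩
    a      ∎
    where open PosetReasoning Γ-poset
  ε≤∞-square nothing _ = tt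

  argmin∞ : ∀ {M} (h : Fin (suc M) → Γ∞) → Σ (Fin (suc M)) λ k* → ∀ k → h k* ≤∞ h k
  argmin∞ {zero}  h = zero , λ { zero → ≤∞-refl (h zero) }
  argmin∞ {suc M} h with k′ , min′ ← argmin∞ (h ∘ suc) with ≤∞-total (h zero) (h (suc k′))
  ... | inj₁ h₀≤ = zero   , λ { zero → ≤∞-refl (h zero) ; (suc k) → ≤∞-trans (h zero) _ _ h₀≤ (min′ k) }
  ... | inj₂ ≤h₀ = suc k′ , λ { zero → ≤h₀ ; (suc k) → min′ k }

  ν-inverse : ∀ p y → p * y ≈ 1# → just ε ≈∞ (ν p +∞ ν y)
  ν-inverse p y py≈1 = ≈∞-trans (just ε) (ν 1#) (ν p +∞ ν y) (≈∞-sym (ν 1#) (just ε) ν-1#)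
    (≈∞-trans (ν 1#) (ν (p * y)) (ν p +∞ ν y) (ν-cong 1# (p * y) (sym py≈1)) (ν-mul p y))

  ν-∞-or-nonzero : ∀ x → IsInf (ν x) ⊎ ¬ x ≈ 0#
  ν-∞-or-nonzero x = split (ν x) (ν-inf₂ x)
    where
    split : ∀ v → (x ≈ 0# → IsInf v) → IsInf v ⊎ ¬ x ≈ 0#
    split nothing  _     = inj₁ tt
    split (just _) x≈0⇒∞ = inj₂ (lower ∘ x≈0⇒∞)

  InO-resp : ∀ {x y} → x ≈ y → InO K x → InO K y
  InO-resp {x} {y} x≈y ε≤νx = ≤∞-respʳ-≈∞ (just ε) (ν x) (ν y) ε≤νx (ν-cong x y x≈y)

  InO-0# : InO K 0#
  InO-0# = ≤∞-∞ (just ε) (ν 0#) (ν-inf₂ 0# refl)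

  InO-1# : InO K 1#
  InO-1# = ≤∞-respʳ-≈∞ (just ε) (just ε) (ν 1#) (≤∞-refl (just ε)) (≈∞-sym (ν 1#) (just ε) ν-1#)

  InO-+ : ∀ x y → InO K x → InO K y → InO K (x + y)
  InO-+ x y ε≤νx ε≤νy with ν-add x y
  ... | inj₁ νx≤ = ≤∞-trans (just ε) (ν x) (ν (x + y)) ε≤νx νx≤
  ... | inj₂ νy≤ = ≤∞-trans (just ε) (ν y) (ν (x + y)) ε≤νy νy≤

  InO-* : ∀ x y → InO K x → InO K y → InO K (x * y)
  InO-* x y ε≤νx ε≤νy = ≤∞-respʳ-≈∞ (just ε) (ν x +∞ ν y) (ν (x * y))
    (ε≤∞-+∞ (ν x) (ν y) ε≤νx ε≤νy) (≈∞-sym (ν (x * y)) (ν x +∞ ν y) (ν-mul x y))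

  InO-neg : ∀ x → InO K x → InO K (- x)
  InO-neg x ε≤νx = InO-resp (-1*x≈-x x) (InO-* (- 1#) x InO-[-1#] ε≤νx)
    where
    InO-[-1#] : InO K (- 1#)
    InO-[-1#] = ε≤∞-square (ν (- 1#)) (ν-inverse (- 1#) (- 1#) (trans (-1*x≈-x (- 1#)) (-‿involutive 1#)))

  InO-sum : ∀ {m} (α : Fin m → Carrier) → (∀ j → InO K (α j)) → InO K (sum α)
  InO-sum {zero}  α _   = InO-0#
  InO-sum {suc m} α α∈O = InO-+ (α zero) _ (α∈O zero) (InO-sum (α ∘ suc) (α∈O ∘ suc))

  InO-quotient : ∀ x p y → p * y ≈ 1# → ν p ≤∞ ν x → InO K (x * y)
  InO-quotient x p y py≈1 νp≤νx = ≤∞-respʳ-≈∞ (just ε) (ν x +∞ ν y) (ν (x * y))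
    (ε≤∞-cancel (ν p) (ν y) (ν x) (ν-inverse p y py≈1) νp≤νx)
    (≈∞-sym (ν (x * y)) (ν x +∞ ν y) (ν-mul x y))

module OSpan {c ℓ g gℓ} (K : ValuedField c ℓ g gℓ) where
  open ValuedField K hiding (zero)
  open ValuationRing K
  open RingProperties ring using (-‿distribˡ-*; -‿distribʳ-*)
  open RingSums ring using (sum-neg)
  open GroupProperties +-group using (//-rightDividesˡ)
  open CommutativeSemigroupProperties +-commutativeSemigroup using (xy∙z≈zy∙x)
  open SemiringSum semiring using (sum; sum-cong-≋; sum-replicate-zero; ∑-distrib-+; *-distribʳ-sum)
  open SetoidReasoning setoid

  sum-shear : ∀ {m} (β u c : Fin m → Carrier) e →
              sum (λ j → β j * (u j - c j * e)) ≈ sum (λ j → β j * u j) - sum (λ j → β j * c j) * e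
  sum-shear β u c e = begin
    sum (λ j → β j * (u j - c j * e))
      ≈⟨ sum-cong-≋ (λ j → trans (distribˡ (β j) (u j) _) (+-congˡ (trans
            (sym (-‿distribʳ-* (β j) (c j * e))) (-‿cong (sym (*-assoc (β j) (c j) e)))))) ⟩
    sum (λ j → β j * u j + - (β j * c j * e))
      ≈⟨ ∑-distrib-+ (λ j → β j * u j) (λ j → - (β j * c j * e)) ⟩
    sum (λ j → β j * u j) + sum (λ j → - (β j * c j * e))
      ≈⟨ +-congˡ (sum-neg (λ j → β j * c j * e)) ⟩
    sum (λ j → β j * u j) - sum (λ j → β j * c j * e)
      ≈⟨ +-congˡ (-‿cong (*-distribʳ-sum e (λ j → β j * c j))) ⟨
    sum (λ j → β j * u j) - sum (λ j → β j * c j) * e ∎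

  unshear : ∀ {m} (β u c : Fin m → Carrier) e a x →
            x - a * e ≈ sum (λ j → β j * (u j - c j * e)) →
            x ≈ (a - sum (λ j → β j * c j)) * e + sum (λ j → β j * u j)
  unshear β u c e a x x-ae≈ = begin
    x                   ≈⟨ //-rightDividesˡ (a * e) x ⟨
    (x - a * e) + a * e ≈⟨ +-congʳ (trans x-ae≈ (sum-shear β u c e)) ⟩
    (S - D * e) + a * e ≈⟨ xy∙z≈zy∙x S (- (D * e)) (a * e) ⟩
    (a * e - D * e) + S ≈⟨ +-congʳ (+-congˡ (-‿distribˡ-* D e)) ⟩
    (a * e + - D * e) + S ≈⟨ +-congʳ (distribʳ e a (- D)) ⟨
    (a - D) * e + S     ∎
    where
    S = sum (λ j → β j * u j)
    D = sum (λ j → β j * c j)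

  IsZero : ∀ {d} → Point K d → Set ℓ
  IsZero x = ∀ t → x t ≈ 0#

  InOSpan : ∀ {d s} → (Fin s → Point K d) → Point K d → Set (c ⊔ ℓ ⊔ gℓ)
  InOSpan {s = s} u x =
    Σ (Fin s → Carrier) λ β → (∀ j → InO K (β j)) × (∀ t → x t ≈ sum (λ j → β j * u j t))

  InOSpan-cong : ∀ {d s} {u u′ : Fin s → Point K d} {x x′ : Point K d} →
                 (∀ j t → u j t ≈ u′ j t) → (∀ t → x t ≈ x′ t) → InOSpan u x → InOSpan u′ x′
  InOSpan-cong u≈u′ x≈x′ (β , β∈O , x≈) =
    β , β∈O , λ t → trans (sym (x≈x′ t)) (trans (x≈ t) (sum-cong-≋ (λ j → *-congˡ (u≈u′ j t))))

  InOSpan-unshear : ∀ {d s} (e : Point K d) (u : Fin s → Point K d) (c : Fin s → Carrier) a x →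
                    (∀ j → InO K (c j)) → InO K a →
                    InOSpan (λ j t → u j t - c j * e t) (λ t → x t - a * e t) → InOSpan (e ∷ u) x
  InOSpan-unshear e u c a x c∈O a∈O (β , β∈O , x-ae≈) = (a - D) ∷ β , coeff∈O , λ t →
    unshear β (λ j → u j t) c (e t) a (x t) (x-ae≈ t)
    where
    D = sum (λ j → β j * c j)
    coeff∈O : ∀ j → InO K (((a - D) ∷ β) j)
    coeff∈O zero    = InO-+ a (- D) a∈O (InO-neg D (InO-sum _ (λ j → InO-* (β j) (c j) (β∈O j) (c∈O j))))
    coeff∈O (suc j) = β∈O j

  InOSpan-tail : ∀ {d s} (u : Fin s → Point K (suc d)) x → x zero ≈ 0# → (∀ j → u j zero ≈ 0#) →
                 InOSpan (λ j → u j ∘ suc) (x ∘ suc) → InOSpan u x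
  InOSpan-tail {s = s} u x x₀≈0 u₀≈0 (β , β∈O , x≈) = β , β∈O , λ
    { zero    → begin
        x zero                        ≈⟨ x₀≈0 ⟩
        0#                            ≈⟨ sum-replicate-zero s ⟨
        sum {s} (λ _ → 0#)            ≈⟨ sum-cong-≋ (λ j → trans (*-congˡ (u₀≈0 j)) (zeroʳ (β j))) ⟨
        sum (λ j → β j * u j zero)    ∎
    ; (suc t) → x≈ t }

  record SpanningSubfamily {d M} (v : Fin M → Point K d) : Set (c ⊔ ℓ ⊔ gℓ) where
    field
      {size}   : ℕ
      size≤d   : size ≤ d
      pivot    : Fin size → Fin M
      pivot≉0  : ∀ j → ¬ IsZero (v (pivot j))
      spans    : ∀ k → InOSpan (v ∘ pivot) (v k)

  spanningSubfamily-tail : ∀ {d M} (v : Fin M → Point K (suc d)) → (∀ k → v k zero ≈ 0#) →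
                           SpanningSubfamily (λ k → v k ∘ suc) → SpanningSubfamily v
  spanningSubfamily-tail v v₀≈0 S = record
    { size≤d  = m≤n⇒m≤1+n size≤d
    ; pivot   = pivot
    ; pivot≉0 = λ j v≈0 → pivot≉0 j (v≈0 ∘ suc)
    ; spans   = λ k → InOSpan-tail (v ∘ pivot) (v k) (v₀≈0 k) (v₀≈0 ∘ pivot) (spans k)
    }
    where open SpanningSubfamily S

  module Elimination {d M} (v : Fin M → Point K (suc d)) (k* : Fin M) (y : Carrier) where
    coeff : Fin M → Carrier
    coeff k = v k zero * y

    shear : Fin M → Point K (suc d)
    shear k t = v k t - coeff k * v k* t

    shear-IsZero : ∀ {k} → IsZero (v k) → IsZero (shear k)
    shear-IsZero {k} vk≈0 t = begin
      v k t - v k zero * y * v k* t  ≈⟨ +-congˡ (-‿cong (*-congʳ (*-congʳ (vk≈0 zero)))) ⟩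
      v k t - 0# * y * v k* t        ≈⟨ +-cong (vk≈0 t) (-‿cong (trans (*-congʳ (zeroˡ y)) (zeroˡ (v k* t)))) ⟩
      0# - 0#                        ≈⟨ -‿inverseʳ 0# ⟩
      0#                             ∎

    module _ (py≈1 : v k* zero * y ≈ 1#) where
      shear-head≈0 : ∀ k → shear k zero ≈ 0#
      shear-head≈0 k = begin
        v k zero - v k zero * y * v k* zero    ≈⟨ +-congˡ (-‿cong (*-assoc (v k zero) y (v k* zero))) ⟩
        v k zero - v k zero * (y * v k* zero)  ≈⟨ +-congˡ (-‿cong (*-congˡ (trans (*-comm y (v k* zero)) py≈1))) ⟩
        v k zero - v k zero * 1#               ≈⟨ +-congˡ (-‿cong (*-identityʳ (v k zero))) ⟩
        v k zero - v k zero                    ≈⟨ -‿inverseʳ (v k zero) ⟩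
        0#                                     ∎

      pivot-nonzero : ¬ IsZero (v k*)
      pivot-nonzero vk*≈0 = nontrivial (begin
        1#               ≈⟨ py≈1 ⟨
        v k* zero * y    ≈⟨ *-congʳ (vk*≈0 zero) ⟩
        0# * y           ≈⟨ zeroˡ y ⟩
        0#               ∎)

      spanningSubfamily-pivot : (∀ k → ν (v k* zero) ≤∞ ν (v k zero)) →
                                SpanningSubfamily (λ k → shear k ∘ suc) → SpanningSubfamily v
      spanningSubfamily-pivot minimal S = record
        { size≤d  = s≤s size≤d
        ; pivot   = k* ∷ pivot
        ; pivot≉0 = λ { zero → pivot-nonzero ; (suc j) v≈0 → pivot≉0 j (shear-IsZero v≈0 ∘ suc) }
        ; spans   = λ k → InOSpan-unshear (v k*) (v ∘ pivot) (coeff ∘ pivot) (coeff k) (v k)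
                            (coeff∈O ∘ pivot) (coeff∈O k)
                            (InOSpan-tail (shear ∘ pivot) (shear k) (shear-head≈0 k) (shear-head≈0 ∘ pivot)
                              (spans k))
        }
        where
        open SpanningSubfamily S
        coeff∈O : ∀ k → InO K (coeff k)
        coeff∈O k = InO-quotient (v k zero) (v k* zero) y py≈1 (minimal k)

  -- Pivoting on a first coordinate of minimal valuation keeps every elimination
  -- coefficient v k 0 / v k* 0 in O.
  spanningSubfamily : ∀ d {M} (v : Fin M → Point K d) → SpanningSubfamily v
  spanningSubfamily zero v = record
    { size≤d = z≤n ; pivot = λ () ; pivot≉0 = λ () ; spans = λ k → (λ ()) , (λ ()) , (λ ()) }
  spanningSubfamily (suc d) {zero} v = record
    { size≤d = z≤n ; pivot = λ () ; pivot≉0 = λ () ; spans = λ () }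
  spanningSubfamily (suc d) {suc M} v
    with k* , minimal ← argmin∞ (λ k → ν (v k zero)) | ν-∞-or-nonzero (v k* zero)
  ... | inj₁ ∞ = spanningSubfamily-tail v heads≈0 (spanningSubfamily d (λ k → v k ∘ suc))
    where
    heads≈0 : ∀ k → v k zero ≈ 0#
    heads≈0 k = ν-inf₁ (v k zero) (∞≤∞⇒∞ (ν (v k* zero)) (ν (v k zero)) ∞ (minimal k))
  ... | inj₂ p≉0 with y , py≈1 ← inverse (v k* zero) p≉0 =
    spanningSubfamily-pivot py≈1 minimal (spanningSubfamily d (λ k → shear k ∘ suc))
    where open Elimination v k* y

module ConvexHull {c ℓ g gℓ} (K : ValuedField c ℓ g gℓ) {n d} (X : Fin n → Point K d) where
  open ValuedField K hiding (zero)
  open ValuationRing K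
  open OSpan K
  open MonoidSums +-monoid using (sum-∘-++)
  open GroupProperties +-group using (//-rightDividesˡ)
  open SemiringSum semiring using (sum; sum-cong-≋; *-distribˡ-sum)

  ValidTerm : ∀ {a} → (Fin n → Set a) → Carrier × Fin n → Set (gℓ ⊔ a)
  ValidTerm U (α , k) = InO K α × U k

  termValue : Fin d → Carrier × Fin n → Carrier
  termValue t (α , k) = α * X k t

  -- The total weight w is arbitrary so that combinations can be scaled and concatenated.
  record Combination {a} (U : Fin n → Set a) (w : Carrier) (p : Point K d) : Set (c ⊔ ℓ ⊔ gℓ ⊔ a) where
    constructor combination
    field
      {size} : ℕ
      terms  : Fin size → Carrier × Fin n
      valid  : ∀ l → ValidTerm U (terms l)
      total  : sum (proj₁ ∘ terms) ≈ w
      point  : ∀ t → p t ≈ sum (termValue t ∘ terms)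

  module _ {a} {U : Fin n → Set a} where

    combination-[] : Combination U 0# (λ _ → 0#)
    combination-[] = record { size = 0 ; terms = λ () ; valid = λ () ; total = refl ; point = λ _ → refl }

    combination-++ : ∀ {w w′ p p′} → Combination U w p → Combination U w′ p′ →
                     Combination U (w + w′) (λ t → p t + p′ t)
    combination-++ C C′ = record
      { terms = C.terms ++ C′.terms
      ; valid = λ l → [_,_] {C = ValidTerm U ∘ [ C.terms , C′.terms ]′} C.valid C′.valid (splitAt C.size l)
      ; total = trans (sum-∘-++ proj₁ C.terms C′.terms) (+-cong C.total C′.total)
      ; point = λ t → trans (+-cong (C.point t) (C′.point t)) (sym (sum-∘-++ (termValue t) C.terms C′.terms))
      }
      where
      module C = Combination C
      module C′ = Combination C′

    combination-scale : ∀ {w p} a → InO K a → Combination U w p → Combination U (a * w) (λ t → a * p t)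
    combination-scale a a∈O C = record
      { terms = map₁ (a *_) ∘ C.terms
      ; valid = λ l → InO-* a _ a∈O (proj₁ (C.valid l)) , proj₂ (C.valid l)
      ; total = trans (sym (*-distribˡ-sum a (proj₁ ∘ C.terms))) (*-congˡ C.total)
      ; point = λ t → trans (*-congˡ (C.point t))
                        (trans (*-distribˡ-sum a (termValue t ∘ C.terms))
                               (sum-cong-≋ {C.size} λ l → sym (*-assoc a (proj₁ (C.terms l)) (X (proj₂ (C.terms l)) t))))
      }
      where module C = Combination C

    combination-cong : ∀ {w w′ p p′} → w ≈ w′ → (∀ t → p t ≈ p′ t) →
                       Combination U w p → Combination U w′ p′
    combination-cong w≈w′ p≈p′ (combination terms valid total point) =
      combination terms valid (trans total w≈w′) (λ t → trans (sym (p≈p′ t)) (point t))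

    InConv⇒Combination : ∀ {p} → InConv K X U p → Combination U 1# p
    InConv⇒Combination (_ , ys , ys∈U , α , α∈O , Σα≈1 , p≈) =
      combination (λ l → α l , ys l) (λ l → α∈O l , ys∈U l) Σα≈1 p≈

    Combination⇒InConv : ∀ {p} → Combination U 1# p → InConv K X U p
    Combination⇒InConv (combination {zero} _ _ 0≈1 _) = ⊥-elim (nontrivial (sym 0≈1))
    Combination⇒InConv (combination {suc m} terms valid Σα≈1 p≈) =
      m , proj₂ ∘ terms , proj₂ ∘ valid , proj₁ ∘ terms , proj₁ ∘ valid , Σα≈1 , p≈

  InConv-∋ : ∀ {a} {U : Fin n → Set a} {k} → U k → InConv K X U (X k)
  InConv-∋ {k = k} k∈U = 0 , (λ _ → k) , (λ _ → k∈U) , (λ _ → 1#) , (λ _ → InO-1#) , +-identityʳ 1# ,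
    λ t → sym (trans (+-identityʳ _) (*-identityˡ _))

  InConv-mono : ∀ {a b} {S : Fin n → Set a} {U : Fin n → Set b} →
                (∀ k → S k → U k) → ∀ p → InConv K X S p → InConv K X U p
  InConv-mono S⊆U p (m , ys , ys∈S , rest) = m , ys , (λ j → S⊆U (ys j) (ys∈S j)) , rest

  module _ {a b} {S : Fin n → Set a} {U : Fin n → Set b} (S⊆convU : ∀ k → S k → InConv K X U (X k)) where

    combination-hull : ∀ {m} (α : Fin m → Carrier) (ys : Fin m → Fin n) →
                       (∀ j → InO K (α j)) → (∀ j → S (ys j)) → Combination U (sum α) (λ t → sum (λ j → α j * X (ys j) t))
    combination-hull {zero}  _ _  _   _    = combination-[]
    combination-hull {suc m} α ys α∈O ys∈S = combination-++
      (combination-cong (*-identityʳ (α zero)) (λ _ → refl)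
        (combination-scale (α zero) (α∈O zero) (InConv⇒Combination (S⊆convU (ys zero) (ys∈S zero)))))
      (combination-hull (α ∘ suc) (ys ∘ suc) (α∈O ∘ suc) (ys∈S ∘ suc))

    InConv-trans : ∀ p → InConv K X S p → InConv K X U p
    InConv-trans p (_ , ys , ys∈S , α , α∈O , Σα≈1 , p≈) =
      Combination⇒InConv (combination-cong Σα≈1 (sym ∘ p≈) (combination-hull α ys α∈O ys∈S))

  -- p − x₀ = Σ βⱼ (xⱼ − x₀) rewrites to p = (1 − Σ βⱼ) x₀ + Σ βⱼ xⱼ.
  InOSpan-differences⇒InConv : ∀ {a s} {U : Fin n → Set a} (x₀ : Fin n) (ι : Fin s → Fin n) →
    U x₀ → (∀ j → U (ι j)) → ∀ p →
    InOSpan (λ j t → X (ι j) t - X x₀ t) (λ t → p t - X x₀ t) → InConv K X U p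
  InOSpan-differences⇒InConv {s = s} x₀ ι x₀∈U ι∈U p p-x₀∈span
    with β , β∈O , p-x₀≈ ← InOSpan-cong {x′ = λ t → p t - 1# * X x₀ t}
                                          (λ j t → +-congˡ (-‿cong (sym (*-identityˡ (X x₀ t)))))
                                          (λ t → +-congˡ (-‿cong (sym (*-identityˡ (X x₀ t)))))
                                          p-x₀∈span =
    s , x₀ ∷ ι , (λ { zero → x₀∈U ; (suc j) → ι∈U j }) , α , α∈O , Σα≈1 ,
    λ t → unshear β (λ j → X (ι j) t) (λ _ → 1#) (X x₀ t) 1# (p t) (p-x₀≈ t)
    where
    D = sum (λ j → β j * 1#)
    α = (1# - D) ∷ β
    α∈O : ∀ j → InO K (α j)
    α∈O zero    = InO-+ 1# (- D) InO-1# (InO-neg D (InO-sum _ (λ j → InO-* (β j) 1# (β∈O j) InO-1#)))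
    α∈O (suc j) = β∈O j
    Σα≈1 : (1# - D) + sum β ≈ 1#
    Σα≈1 = trans (+-congˡ (sum-cong-≋ (λ j → sym (*-identityʳ (β j))))) (//-rightDividesˡ D 1#)

open import Data.Nat using (_+_; _*_)
open import Data.Nat.Properties
  using (*-zeroʳ; *-suc; +-suc; +-assoc; +-identityʳ; +-mono-≤; +-monoʳ-<; +-cancelˡ-<; +-cancelˡ-≤;
         ≤-reflexive; ≤-trans; m≤m+n; m+[n∸m]≡n; m+n∸m≡n; ∸-+-assoc; suc-injective;
         +-commutativeSemigroup; module ≤-Reasoning)
open import Algebra.Properties.CommutativeSemigroup +-commutativeSemigroup using (x∙yz≈y∙xz)
open ≡ using (refl; sym; trans; cong; cong₂; subst; module ≡-Reasoning)

indicator : Bool → ℕ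
indicator true  = 1
indicator false = 0

count : ∀ {n} → (Fin n → Bool) → ℕ
count {zero}  B = 0
count {suc n} B = indicator (B zero) + count (B ∘ suc)

_⊆_ : ∀ {n} → (Fin n → Bool) → (Fin n → Bool) → Set
B ⊆ R = ∀ k → B k ≡ true → R k ≡ true

_─_ : ∀ {n} → (Fin n → Bool) → (Fin n → Bool) → Fin n → Bool
(R ─ B) k = R k ∧ not (B k)

insert : ∀ {n} → Fin n → (Fin n → Bool) → Fin n → Bool
insert k B l = does (k ≟ l) ∨ B l

image : ∀ {m n} → (Fin m → Fin n) → Fin n → Bool
image {zero}  ys = λ _ → false
image {suc m} ys = insert (ys zero) (image (ys ∘ suc))

count-cong : ∀ {n} {B C : Fin n → Bool} → (∀ k → B k ≡ C k) → count B ≡ count C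
count-cong {zero}  e = refl
count-cong {suc n} e = cong₂ _+_ (cong indicator (e zero)) (count-cong (e ∘ suc))

count-none : ∀ n → count {n} (λ _ → false) ≡ 0
count-none zero    = refl
count-none (suc n) = count-none n

count-all : ∀ n → count {n} (λ _ → true) ≡ n
count-all zero    = refl
count-all (suc n) = cong suc (count-all n)

count-⊆-split : ∀ {n} {B R : Fin n → Bool} → B ⊆ R → count R ≡ count B + count (R ─ B)
count-⊆-split {zero} _ = refl
count-⊆-split {suc n} {B} {R} B⊆R with R zero | B zero | B⊆R zero
... | true  | true  | _ = cong suc (count-⊆-split (B⊆R ∘ suc))
... | true  | false | _ = trans (cong suc (count-⊆-split (B⊆R ∘ suc))) (sym (+-suc _ _))
... | false | false | _ = count-⊆-split (B⊆R ∘ suc)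
... | false | true  | h with () ← h refl

count-witness : ∀ {n} (R : Fin n → Bool) → 0 < count R → Σ (Fin n) λ k → R k ≡ true
count-witness {suc n} R h with R zero in eq
... | true  = zero , eq
... | false with k , e ← count-witness (R ∘ suc) h = suc k , e

count-insert : ∀ {n} k (B : Fin n → Bool) → count (insert k B) ≡ indicator (not (B k)) + count B
count-insert {suc n} zero B with B zero
... | true  = refl
... | false = refl
count-insert {suc n} (suc k) B = begin
  indicator (B zero) + count (insert k (B ∘ suc))
    ≡⟨ cong (indicator (B zero) +_) (count-insert k (B ∘ suc)) ⟩
  indicator (B zero) + (indicator (not (B (suc k))) + count (B ∘ suc))
    ≡⟨ x∙yz≈y∙xz (indicator (B zero)) (indicator (not (B (suc k)))) (count (B ∘ suc)) ⟩
  indicator (not (B (suc k))) + (indicator (B zero) + count (B ∘ suc)) ∎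
  where open ≡-Reasoning

count-insert-new : ∀ {n} {k} {B : Fin n → Bool} → B k ≡ false → count (insert k B) ≡ suc (count B)
count-insert-new {k = k} {B} Bk = trans (count-insert k B) (cong (λ b → indicator (not b) + count B) Bk)

insert-∋ : ∀ {n} k (B : Fin n → Bool) → insert k B k ≡ true
insert-∋ k B = cong (_∨ B k) (dec-true (k ≟ k) refl)

⊆-insert : ∀ {n} k (B : Fin n → Bool) → B ⊆ insert k B
⊆-insert k B l e = trans (cong (does (k ≟ l) ∨_) e) (∨-zeroʳ _)

insert-⊆ : ∀ {n} {k} {B R : Fin n → Bool} → R k ≡ true → B ⊆ R → insert k B ⊆ R
insert-⊆ {k = k} {B} Rk B⊆R l e with k ≟ l
... | yes refl = Rk
... | no _     = B⊆R l e

image-∋ : ∀ {m n} (ys : Fin m → Fin n) j → image ys (ys j) ≡ true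
image-∋ ys zero    = insert-∋ (ys zero) (image (ys ∘ suc))
image-∋ ys (suc j) = ⊆-insert (ys zero) (image (ys ∘ suc)) (ys (suc j)) (image-∋ (ys ∘ suc) j)

image-⊆ : ∀ {m n} (ys : Fin m → Fin n) {R} → (∀ j → R (ys j) ≡ true) → image ys ⊆ R
image-⊆ {zero}  ys R∋ k ()
image-⊆ {suc m} ys R∋ = insert-⊆ (R∋ zero) (image-⊆ (ys ∘ suc) (R∋ ∘ suc))

count-image : ∀ {m n} (ys : Fin m → Fin n) → count (image ys) ≤ m
count-image {zero}  {n} ys = ≤-reflexive (count-none n)
count-image {suc m} ys rewrite count-insert (ys zero) (image (ys ∘ suc)) =
  +-mono-≤ (indicator≤1 _) (count-image (ys ∘ suc))
  where
  indicator≤1 : ∀ b → indicator b ≤ 1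
  indicator≤1 true  = s≤s z≤n
  indicator≤1 false = z≤n

∧-not-true : ∀ {a b} → a ∧ not b ≡ true → a ≡ true × b ≡ false
∧-not-true {true} {false} _ = refl , refl

⊆-extend-by : ∀ {n} {B₀ R : Fin n → Bool} g → B₀ ⊆ R → count B₀ + g ≤ count R →
           Σ (Fin n → Bool) λ B → B₀ ⊆ B × B ⊆ R × count B ≡ count B₀ + g
⊆-extend-by {B₀ = B₀} zero B₀⊆R _ = B₀ , (λ _ → id) , B₀⊆R , sym (+-identityʳ _)
⊆-extend-by {n} {B₀} {R} (suc g) B₀⊆R h = grow (count-witness (R ─ B₀) room)
  where
  room : 0 < count (R ─ B₀)
  room = +-cancelˡ-< (count B₀) 0 _ (begin-strict
    count B₀ + 0               <⟨ +-monoʳ-< (count B₀) (s≤s z≤n) ⟩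
    count B₀ + suc g           ≤⟨ h ⟩
    count R                    ≡⟨ count-⊆-split B₀⊆R ⟩
    count B₀ + count (R ─ B₀)  ∎)
    where open ≤-Reasoning
  count-B₁+g : ∀ {k} → B₀ k ≡ false → count (insert k B₀) + g ≡ count B₀ + suc g
  count-B₁+g {k} B₀k = trans (cong (_+ g) (count-insert-new {k = k} {B₀} B₀k)) (sym (+-suc (count B₀) g))
  grow : Σ (Fin n) (λ k → (R ─ B₀) k ≡ true) →
         Σ (Fin n → Bool) λ B → B₀ ⊆ B × B ⊆ R × count B ≡ count B₀ + suc g
  grow (k , e) with Rk , B₀k ← ∧-not-true e
    with B , B₁⊆B , B⊆R , countB ← ⊆-extend-by g (insert-⊆ Rk B₀⊆R) (≤-trans (≤-reflexive (count-B₁+g B₀k)) h)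
    = 
    B , (λ l → B₁⊆B l ∘ ⊆-insert k B₀ l) , B⊆R , trans countB (count-B₁+g B₀k)

⊆-extend-to : ∀ {n} {B₀ R : Fin n → Bool} {N} → B₀ ⊆ R → count B₀ ≤ N → N ≤ count R →
              Σ (Fin n → Bool) λ B → B₀ ⊆ B × B ⊆ R × count B ≡ N
⊆-extend-to {B₀ = B₀} {N = N} B₀⊆R |B₀|≤N N≤|R| rewrite sym (m+[n∸m]≡n |B₀|≤N) =
  ⊆-extend-by (N ∸ count B₀) B₀⊆R N≤|R|

length-filter-tabulate : ∀ {a p n} {A : Set a} {P : A → Set p} (P? : ∀ x → Dec (P x)) (f : Fin n → A) →
                         length (filter P? (tabulate f)) ≡ count (does ∘ P? ∘ f)
length-filter-tabulate {n = zero}  P? f = refl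
length-filter-tabulate {n = suc n} P? f with does (P? (f zero))
... | true  = cong suc (length-filter-tabulate P? (f ∘ suc))
... | false = length-filter-tabulate P? (f ∘ suc)

module CoveringSubset {c ℓ g gℓ} (K : ValuedField c ℓ g gℓ) {n d} (X : Fin n → Point K d) where
  open ValuedField K using (_≈_; _-_; 0#) renaming (refl to ≈-refl)
  open OSpan K
  open ConvexHull K X

  ConvCovers : (Fin n → Bool) → (Fin n → Bool) → Set _
  ConvCovers B R = ∀ k → R k ≡ true → InConv K X (λ l → B l ≡ true) (X k)

  CoveringSubset : (Fin n → Bool) → Set _
  CoveringSubset R = Σ (Fin n → Bool) λ B → B ⊆ R × count B ≡ suc d × ConvCovers B R

  module _ (R : Fin n → Bool) {x₀ : Fin n} (R∋x₀ : R x₀ ≡ true) where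
    private
      -- Outside R the differences are replaced by 0, so the (nonzero) pivots lie in R.
      v : Fin n → Point K d
      v k = if R k then (λ t → X k t - X x₀ t) else (λ _ → 0#)

      v-∈R : ∀ {k} → R k ≡ true → ∀ t → v k t ≈ X k t - X x₀ t
      v-∈R e rewrite e = λ _ → ≈-refl

      v-∉R : ∀ {k} → R k ≡ false → IsZero (v k)
      v-∉R e rewrite e = λ _ → ≈-refl

    open SpanningSubfamily (spanningSubfamily d v)

    private
      pivot∈R : ∀ j → R (pivot j) ≡ true
      pivot∈R j with R (pivot j) in e
      ... | true  = ≡.refl
      ... | false = ⊥-elim (pivot≉0 j (v-∉R e))

      ys : Fin (suc size) → Fin n
      ys = x₀ ∷ pivot

      ys∈R : ∀ j → R (ys j) ≡ true
      ys∈R zero    = R∋x₀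
      ys∈R (suc j) = pivot∈R j

    coveringSubset-∋ : suc d ≤ count R → CoveringSubset R
    coveringSubset-∋ d<|R|
      with B , B₀⊆B , B⊆R , |B|≡1+d ← ⊆-extend-to (image-⊆ ys ys∈R) (≤-trans (count-image ys) (s≤s size≤d)) d<|R|
      = 
      B , B⊆R , |B|≡1+d , λ k Rk →
        InOSpan-differences⇒InConv x₀ pivot (ys∈B zero) (ys∈B ∘ suc) (X k)
          (InOSpan-cong (λ j → v-∈R (pivot∈R j)) (v-∈R Rk) (spans k))
      where
      ys∈B : ∀ j → B (ys j) ≡ true
      ys∈B j = B₀⊆B (ys j) (image-∋ ys j)

  coveringSubset : ∀ R → suc d ≤ count R → CoveringSubset R
  coveringSubset R d<|R| with _ , R∋x₀ ← count-witness R (≤-trans (s≤s z≤n) d<|R|) =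
    coveringSubset-∋ R R∋x₀ d<|R|

fiber : ∀ {n r} → (Fin n → Fin r) → Fin r → Fin n → Bool
fiber f i k = does (f k ≟ i)

_∩_ : ∀ {n} → (Fin n → Bool) → (Fin n → Bool) → Fin n → Bool
(R ∩ B) k = R k ∧ B k

prepend : ∀ {n r} → (Fin n → Bool) → (Fin n → Fin r) → Fin n → Fin (suc r)
prepend B f k = if B k then zero else suc (f k)

module _ {n r} {B : Fin n → Bool} {f : Fin n → Fin r} where

  prepend-zero : ∀ {R} → B ⊆ R → ∀ k → (R ∩ fiber (prepend B f) zero) k ≡ B k
  prepend-zero {R} B⊆R k with B k in e
  ... | true  = trans (∧-identityʳ _) (B⊆R k e)
  ... | false = ∧-zeroʳ (R k)

  prepend-suc : ∀ {R} i k → (R ∩ fiber (prepend B f) (suc i)) k ≡ ((R ─ B) ∩ fiber f i) k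
  prepend-suc {R} i k with R k | B k
  ... | true  | true  = refl
  ... | true  | false = refl
  ... | false | _     = refl

  prepend-≡suc : ∀ {k j} → prepend B f k ≡ suc j → B k ≡ false × f k ≡ j
  prepend-≡suc {k} e with B k
  ... | false = refl , Fin.suc-injective e

module _ {c ℓ g gℓ} (K : ValuedField c ℓ g gℓ) {n d} (X : Fin n → Point K d) where
  open ConvexHull K X
  open CoveringSubset K X

  Part : ∀ {r} → (Fin n → Bool) → (Fin n → Fin r) → Fin r → Fin n → Set
  Part R f i l = R l ≡ true × f l ≡ i

  record IsChainPartition (R : Fin n → Bool) (r : ℕ) (f : Fin n → Fin (suc r)) : Set (c ⊔ ℓ ⊔ gℓ) where
    field
      inner-size : ∀ i → toℕ i < r → count (R ∩ fiber f i) ≡ suc d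
      last-size  : ∀ i → toℕ i ≡ r → count (R ∩ fiber f i) ≡ count R ∸ suc d * r
      nested     : ∀ i j → toℕ i ≤ toℕ j → ∀ k → Part R f j k → InConv K X (Part R f i) (X k)

  private
    count-remainder : ∀ {B R : Fin n → Bool} → B ⊆ R → count B ≡ suc d →
                      count R ≡ suc d + count (R ─ B)
    count-remainder {B} {R} B⊆R |B|≡ = trans (count-⊆-split B⊆R) (cong (_+ count (R ─ B)) |B|≡)

    room-split : ∀ r {m} → suc d * suc r + 1 ≤ m → suc d + (suc d * r + 1) ≤ m
    room-split r {m} = subst (_≤ m) (trans (cong (_+ 1) (*-suc (suc d) r)) (+-assoc (suc d) (suc d * r) 1))

  IsChainPartition-prepend : ∀ {R B : Fin n → Bool} {r} {f : Fin n → Fin (suc r)} →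
                             B ⊆ R → count B ≡ suc d → ConvCovers B R → IsChainPartition (R ─ B) r f → IsChainPartition R (suc r) (prepend B f)
  IsChainPartition-prepend {R} {B} {r} {f} B⊆R |B|≡ B-covers P = record
    { inner-size = inner-size′ ; last-size = last-size′ ; nested = nested′ }
    where
    open IsChainPartition P

    inner-size′ : ∀ i → toℕ i < suc r → count (R ∩ fiber (prepend B f) i) ≡ suc d
    inner-size′ zero    _         = trans (count-cong (prepend-zero {B = B} {f} B⊆R)) |B|≡
    inner-size′ (suc i) (s≤s i<r) = trans (count-cong (prepend-suc {B = B} {f} {R} i)) (inner-size i i<r)

    last-size′ : ∀ i → toℕ i ≡ suc r → count (R ∩ fiber (prepend B f) i) ≡ count R ∸ suc d * suc r
    last-size′ (suc i) i≡r = begin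
      count (R ∩ fiber (prepend B f) (suc i))    ≡⟨ count-cong (prepend-suc {B = B} {f} {R} i) ⟩
      count ((R ─ B) ∩ fiber f i)                ≡⟨ last-size i (suc-injective i≡r) ⟩
      count (R ─ B) ∸ suc d * r
        ≡⟨ cong (_∸ suc d * r) (m+n∸m≡n (suc d) (count (R ─ B))) ⟨
      suc d + count (R ─ B) ∸ suc d ∸ suc d * r
        ≡⟨ cong (λ m → m ∸ suc d ∸ suc d * r) (count-remainder B⊆R |B|≡) ⟨
      count R ∸ suc d ∸ suc d * r                ≡⟨ ∸-+-assoc (count R) (suc d) (suc d * r) ⟩
      count R ∸ (suc d + suc d * r)              ≡⟨ cong (count R ∸_) (*-suc (suc d) r) ⟨
      count R ∸ suc d * suc r                    ∎
      where open ≡-Reasoning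

    nested′ : ∀ i j → toℕ i ≤ toℕ j → ∀ k → Part R (prepend B f) j k →
              InConv K X (Part R (prepend B f) i) (X k)
    nested′ zero    _       _         k (Rk , _) =
      InConv-mono (λ l Bl → B⊆R l Bl , cong (λ b → if b then zero else suc (f l)) Bl) (X k) (B-covers k Rk)
    nested′ (suc i) (suc j) (s≤s i≤j) k (Rk , fk≡) with Bk , fk≡j ← prepend-≡suc {B = B} {f} fk≡ =
      InConv-mono lift (X k) (nested i j i≤j k (R─B∋k , fk≡j))
      where
      R─B∋k : (R ─ B) k ≡ true
      R─B∋k = trans (cong (λ b → R k ∧ not b) Bk) (trans (∧-identityʳ (R k)) Rk)
      lift : ∀ l → Part (R ─ B) f i l → Part R (prepend B f) (suc i) l
      lift l (R─B∋l , fl≡i) with Rl , Bl ← ∧-not-true R─B∋l =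
        Rl , trans (cong (λ b → if b then zero else suc (f l)) Bl) (cong suc fl≡i)

  chainPartition : ∀ r R → suc d * r + 1 ≤ count R → Σ (Fin n → Fin (suc r)) (IsChainPartition R r)
  chainPartition zero R _ = (λ _ → zero) , record
    { inner-size = λ _ ()
    ; last-size  = λ { zero _ → trans (count-cong (λ k → ∧-identityʳ (R k)))
                                      (cong (count R ∸_) (sym (*-zeroʳ (suc d)))) }
    ; nested     = λ { zero zero _ k (Rk , _) → InConv-∋ (Rk , refl) }
    }
  chainPartition (suc r) R room
    with B , B⊆R , |B|≡ , B-covers ← coveringSubset R (≤-trans (m≤m+n (suc d) _) (room-split r room))
    with f , P ← chainPartition r (R ─ B) (+-cancelˡ-≤ (suc d) _ _
                   (subst (suc d + (suc d * r + 1) ≤_) (count-remainder B⊆R |B|≡) (room-split r room)))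
    = prepend B f , IsChainPartition-prepend B⊆R |B|≡ B-covers P

theorem4p15 : ∀ {c ℓ g gℓ : Level} (K : ValuedField c ℓ g gℓ) (d r : ℕ) → 1 ≤ d → 1 ≤ r →
    (n : ℕ) (X : Fin n → Point K d) →
    (∀ k l → _≈P_ K (X k) (X l) → k ≡ l) →
    (suc d) * (r ∸ 1) + 1 ≤ n →
    Σ (Fin n → Fin r) λ f →
      (∀ i → (toℕ i < r ∸ 1 → fiberSize f i ≡ suc d) ×
             (toℕ i ≡ r ∸ 1 → fiberSize f i ≡ n ∸ (suc d) * (r ∸ 1))) ×
      (∀ i j → toℕ i ≤ toℕ j → ∀ p →
         InConv K X (λ k → f k ≡ j) p → InConv K X (λ k → f k ≡ i) p)
theorem4p15 K d (suc r) _ _ n X _ room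
  with f , P ← chainPartition K X r (λ _ → true) (subst (suc d * r + 1 ≤_) (sym (count-all n)) room) =
  f , sizes , nested-hulls
  where
  open IsChainPartition P
  open ConvexHull K X

  fiberSize≡count : ∀ i → fiberSize f i ≡ count ((λ _ → true) ∩ fiber f i)
  fiberSize≡count i = length-filter-tabulate (λ k → f k ≟ i) id

  sizes : ∀ i → (toℕ i < r → fiberSize f i ≡ suc d) × (toℕ i ≡ r → fiberSize f i ≡ n ∸ suc d * r)
  sizes i = (λ i<r → trans (fiberSize≡count i) (inner-size i i<r)) ,
            (λ i≡r → trans (fiberSize≡count i) (trans (last-size i i≡r) (cong (_∸ suc d * r) (count-all n))))

  nested-hulls : ∀ i j → toℕ i ≤ toℕ j → ∀ p →
                 InConv K X (λ k → f k ≡ j) p → InConv K X (λ k → f k ≡ i) p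
  nested-hulls i j i≤j = InConv-trans {U = λ k → f k ≡ i} λ k fk≡j →
    InConv-mono {S = Part K X (λ _ → true) f i} (λ _ → proj₂) (X k) (nested i j i≤j k (refl , fk≡j))
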